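{- Let $T$ be a tree rooted in a vertex $r$, let $\tau$ be a threshold function for $T$, let $u$ be a vertex of $T$ and $b$ a non-negative integer. Then $x_0(u,b)\geq x_1(u,b)$. Moreover, if $x_0(u,b)=x_1(u,b)$ and $b\leq n(T_u)$, then there exists a set $X\subseteq V(T_u)$ with $|X|=b$ such that simultaneously ${\rm dyn}(T_u,\tau_X)=x_0(u,b)$ and ${\rm dyn}(T_u,\tau^u_X)=x_1(u,b)$.
   Context: A threshold function for a graph $G$ is a function $\tau:U\to\mathbb{Z}\cup\{\infty\}$ whose domain $U$ contains $V(G)$. For $D\subseteq V(G)$, the hull $H_{(G,\tau)}(D)$ is the smallest $H\subseteq V(G)$ with $D\subseteq H$ and $u\in H$ for every vertex $u$ with $|H\cap N_G(u)|\geq\tau(u)$; $D$ is a dynamic monopoly if $H_{(G,\tau)}(D)=V(G)$; ${\rm dyn}(G,\tau)$ is the minimum order of a dynamic monopoly. For a set $X$, $\tau_X$ equals $\tau$ on $U\setminus X$ and $\infty$ on $U\cap X$. For a vertex $u$, $\tau^u$ equals $\tau$ except that $\tau^u(u)=\tau(u)-1$; $\tau^u_X=(\tau^u)_X$. ${\rm vacc}_1(G,\tau,b)=\max\{{\rm dyn}(G,\tau_X):X\subseteq V(G),|X|=b\}$ with $\max\emptyset=-\infty$. $T_u$ denotes the subtree of $T$ induced by $u$ and its descendants, $n(T_u)$ its order, and $x_0(u,b)={\rm vacc}_1(T_u,\tau,b)$, $x_1(u,b)={\rm vacc}_1(T_u,\tau^u,b)$. -}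

module Defs where

open import Data.Nat using (ℕ; zero; suc; _≤_)
open import Data.Integer using (ℤ; +_; _-_) renaming (_≤_ to _≤ℤ_)
open import Data.Fin using (Fin)
open import Data.Fin.Subset using (Subset; _∈_; _⊆_; _∩_; ∣_∣)
open import Data.Fin.Subset.Properties using (_∈?_)
open import Data.Vec using (tabulate)
open import Data.Bool using (Bool)
open import Data.Maybe using (Maybe; just; nothing)
open import Data.Product using (Σ; ∃; _×_; _,_)
open import Data.Sum using (_⊎_)
open import Data.Empty using (⊥)
open import Data.Unit using (⊤)
open import Relation.Nullary using (¬_; yes; no; Dec)
open import Relation.Nullary.Decidable using (⌊_⌋)
open import Relation.Binary.PropositionalEquality using (_≡_; _≢_)
open import Data.Fin using (_≟_)

data ℤ∞ : Set where
  fin : ℤ → ℤ∞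
  ∞   : ℤ∞

_≥∞_ : ℕ → ℤ∞ → Set
k ≥∞ fin z = z ≤ℤ + k
k ≥∞ ∞     = ⊥

Threshold : ℕ → Set
Threshold n = Fin n → ℤ∞

_restrict_ : ∀ {n} → Threshold n → Subset n → Threshold n
(τ restrict X) v with v ∈? X
... | yes _ = ∞
... | no  _ = τ v

dec∞ : ℤ∞ → ℤ∞
dec∞ (fin z) = fin (z - + 1)
dec∞ ∞       = ∞

lower : ∀ {n} → Threshold n → Fin n → Threshold n
lower τ u v with v ≟ u
... | yes _ = dec∞ (τ u)
... | no  _ = τ v

iter : ∀ {A : Set} → (A → A) → ℕ → A → A
iter f zero    a = a
iter f (suc k) a = f (iter f k a)

record RootedTree (n : ℕ) : Set where
  field
    root       : Fin n
    parent     : Fin n → Fin n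
    parentRoot : parent root ≡ root
    reachRoot  : ∀ v → ∃ λ k → iter parent k v ≡ root

  Adj : Fin n → Fin n → Set
  Adj v w = (v ≢ root × parent v ≡ w) ⊎ (w ≢ root × parent w ≡ v)

  adj? : ∀ v w → Dec (Adj v w)
  adj? v w with v ≟ root | w ≟ root | parent v ≟ w | parent w ≟ v
  ... | no p | _ | yes q | _ = yes (Data.Sum.inj₁ (p , q))
  ... | _ | no p | _ | yes q = yes (Data.Sum.inj₂ (p , q))
  ... | yes p | yes p' | _ | _ = no λ { (Data.Sum.inj₁ (a , _)) → a p ; (Data.Sum.inj₂ (a , _)) → a p' }
  ... | yes p | no _ | _ | no q = no λ { (Data.Sum.inj₁ (a , _)) → a p ; (Data.Sum.inj₂ (_ , b)) → q b }
  ... | no _ | yes p' | no q | _ = no λ { (Data.Sum.inj₁ (_ , b)) → q b ; (Data.Sum.inj₂ (a , _)) → a p' }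
  ... | no _ | no _ | no q | no q' = no λ { (Data.Sum.inj₁ (_ , b)) → q b ; (Data.Sum.inj₂ (_ , b)) → q' b }

  N : Fin n → Subset n
  N v = tabulate λ w → ⌊ adj? v w ⌋

  Descendant : Fin n → Fin n → Set
  Descendant u w = ∃ λ k → iter parent k w ≡ u

-- Dynamic monopolies in the induced subgraph T[W] (vertex set W).
-- Only induced subgraphs of a rooted tree are needed (T_u = T[V(T_u)]).

module _ {n : ℕ} (T : RootedTree n) (W : Subset n) (τ : Threshold n) where
  open RootedTree T

  Closed : Subset n → Set
  Closed H = ∀ v → v ∈ W → ∣ H ∩ (N v ∩ W) ∣ ≥∞ τ v → v ∈ H

  IsHull : Subset n → Subset n → Set
  IsHull D H = H ⊆ W × D ⊆ H × Closed H
             × (∀ H' → H' ⊆ W → D ⊆ H' → Closed H' → H ⊆ H')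

  IsDynMon : Subset n → Set
  IsDynMon D = D ⊆ W × ∃ λ H → IsHull D H × H ≡ W

  IsDyn : ℕ → Set
  IsDyn k = (∃ λ D → IsDynMon D × ∣ D ∣ ≡ k)
          × (∀ D → IsDynMon D → k ≤ ∣ D ∣)

-- vacc₁(T[W], τ, b) = v, with nothing standing for -∞ (max ∅)
IsVacc : ∀ {n} → RootedTree n → Subset n → Threshold n → ℕ → Maybe ℕ → Set
IsVacc T W τ b nothing  = ∀ X → X ⊆ W → ∣ X ∣ ≢ b
IsVacc T W τ b (just m) =
    (∃ λ X → X ⊆ W × ∣ X ∣ ≡ b × IsDyn T W (τ restrict X) m)
  × (∀ X d → X ⊆ W → ∣ X ∣ ≡ b → IsDyn T W (τ restrict X) d → d ≤ m)

_≤⁻∞_ : Maybe ℕ → Maybe ℕ → Set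
nothing ≤⁻∞ _       = ⊤
just a  ≤⁻∞ nothing = ⊥
just a  ≤⁻∞ just b  = a ≤ b

-- Lowering thresholds can only shrink the minimum dynamic monopoly, so for a
-- fixed vaccinated set X we have dyn(T_u, τ^u_X) ≤ dyn(T_u, τ_X) ≤ x₀(u,b).
-- Taking for X a set realising x₁(u,b) gives x₁ ≤ x₀, and when x₀ = x₁ the
-- whole chain collapses, so this same X realises both values.
module Submission where

open import Defs
open import Data.Nat using (ℕ; _≤_)
open import Data.Fin using (Fin)
open import Data.Fin.Subset using (Subset; _∈_; _⊆_; ∣_∣)
open import Data.Maybe using (Maybe; just)
open import Data.Maybe using (nothing)
open import Data.Product using (∃; _×_; _,_)
open import Function.Bundles using (_⇔_)
open import Relation.Binary.PropositionalEquality using (_≡_)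

open import Data.Nat using (zero; suc; _<_; s≤s; _≟_)
open import Data.Nat.Properties using (≤-trans; ≤-antisym; ≮⇒≥; anyUpTo?)
open import Data.Nat.Induction using (<-wellFounded)
open import Induction.WellFounded using (Acc; acc)
open import Data.Integer as ℤ using (+_)
open import Data.Integer.Properties as ℤ using (i-j≤i)
open import Data.Fin using () renaming (_≟_ to _≟ᶠ_)
open import Data.Fin.Properties using (all?)
open import Data.Fin.Subset using (_∩_; inside; outside) renaming (⊥ to ∅)
open import Data.Fin.Subset.Properties
  using (_∈?_; _⊆?_; anySubset?; ⊥⊆; ∣⊥∣≡0; s⊆s; out⊆)
open import Data.Vec using ([]; _∷_)
open import Data.Vec.Properties using (≡-dec)
open import Data.Bool.Properties using () renaming (_≟_ to _≟ᵇ_)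
open import Data.Unit using (tt)
open import Data.Empty using (⊥-elim)
open import Function using (id)
open import Relation.Nullary using (Dec; yes; no)
open import Relation.Nullary.Decidable using (_×-dec_; _→-dec_; ¬?; decidable-stable)
open import Relation.Unary using (Pred; Decidable)
open import Relation.Binary.PropositionalEquality using (refl; cong; subst)

least-witness : ∀ {p} {P : Pred ℕ p} → Decidable P → ∀ {k} → P k →
                ∃ λ m → P m × (∀ {j} → P j → m ≤ j)
least-witness {P = P} P? {k} pk = go pk (<-wellFounded k)
  where
  go : ∀ {k} → P k → Acc _<_ k → ∃ λ m → P m × (∀ {j} → P j → m ≤ j)
  go {k} pk (acc rs) with anyUpTo? P? k
  ... | yes (j , j<k , pj) = go pj (rs j<k)
  ... | no none            = k , pk , λ pj → ≮⇒≥ λ j<k → none (_ , j<k , pj)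

allSubset? : ∀ {n p} {P : Pred (Subset n) p} → Decidable P → Dec (∀ X → P X)
allSubset? P? with anySubset? (λ X → ¬? (P? X))
... | yes (X , ¬pX) = no λ all → ¬pX (all X)
... | no  none      = yes λ X → decidable-stable (P? X) λ ¬pX → none (X , ¬pX)

subset-of-size : ∀ {n} (W : Subset n) b → b ≤ ∣ W ∣ → ∃ λ X → X ⊆ W × ∣ X ∣ ≡ b
subset-of-size {n} W zero _ = ∅ , ⊥⊆ , ∣⊥∣≡0 n
subset-of-size [] (suc b) ()
subset-of-size (inside ∷ W) (suc b) (s≤s b≤∣W∣) with subset-of-size W b b≤∣W∣
... | X , X⊆W , ∣X∣≡b = inside ∷ X , s⊆s X⊆W , cong suc ∣X∣≡b
subset-of-size (outside ∷ W) (suc b) b<∣W∣ with subset-of-size W (suc b) b<∣W∣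
... | X , X⊆W , ∣X∣≡b = outside ∷ X , out⊆ X⊆W , ∣X∣≡b

data _≤∞_ : ℤ∞ → ℤ∞ → Set where
  fin≤fin : ∀ {a b} → a ℤ.≤ b → fin a ≤∞ fin b
  ≤∞-top  : ∀ t → t ≤∞ ∞

_≤τ_ : ∀ {n} → Threshold n → Threshold n → Set
σ′ ≤τ σ = ∀ v → σ′ v ≤∞ σ v

≥∞-antitone : ∀ {s t} k → s ≤∞ t → k ≥∞ t → k ≥∞ s
≥∞-antitone k (fin≤fin a≤b) b≤k = ℤ.≤-trans a≤b b≤k
≥∞-antitone k (≤∞-top _)    ()

_≥∞?_ : ∀ k t → Dec (k ≥∞ t)
k ≥∞? fin z = z ℤ.≤? + k
k ≥∞? ∞     = no λ ()

≤∞-refl : ∀ t → t ≤∞ t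
≤∞-refl (fin z) = fin≤fin ℤ.≤-refl
≤∞-refl ∞       = ≤∞-top ∞

dec∞-≤∞ : ∀ t → dec∞ t ≤∞ t
dec∞-≤∞ (fin z) = fin≤fin (i-j≤i z (+ 1))
dec∞-≤∞ ∞       = ≤∞-top ∞

lower-≤τ : ∀ {n} (τ : Threshold n) u → lower τ u ≤τ τ
lower-≤τ τ u v with v ≟ᶠ u
... | yes refl = dec∞-≤∞ (τ v)
... | no  _    = ≤∞-refl (τ v)

restrict-mono : ∀ {n} {σ′ σ : Threshold n} X → σ′ ≤τ σ → (σ′ restrict X) ≤τ (σ restrict X)
restrict-mono X σ′≤σ v with v ∈? X
... | yes _ = ≤∞-top ∞
... | no  _ = σ′≤σ v

module _ {n : ℕ} (T : RootedTree n) (W : Subset n) where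
  open RootedTree T

  Closed-antitone : ∀ {σ′ σ H} → σ′ ≤τ σ → Closed T W σ′ H → Closed T W σ H
  Closed-antitone σ′≤σ closed v v∈W active = closed v v∈W (≥∞-antitone _ (σ′≤σ v) active)

  -- σ′-closed sets are σ-closed, so W, the σ-hull of D, is also its σ′-hull.
  isDynMon-antitone : ∀ {σ′ σ D} → σ′ ≤τ σ → IsDynMon T W σ D → IsDynMon T W σ′ D
  isDynMon-antitone {σ′} {D = D} σ′≤σ (D⊆W , _ , (_ , _ , _ , minimal) , refl) =
    D⊆W , W , (id , D⊆W , (λ _ v∈W _ → v∈W) , hull-least) , refl
    where
    hull-least : ∀ H′ → H′ ⊆ W → D ⊆ H′ → Closed T W σ′ H′ → W ⊆ H′
    hull-least H′ H′⊆W D⊆H′ closed = minimal H′ H′⊆W D⊆H′ (Closed-antitone σ′≤σ closed)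

  isDyn-antitone : ∀ {σ′ σ m′ m} → σ′ ≤τ σ → IsDyn T W σ′ m′ → IsDyn T W σ m → m′ ≤ m
  isDyn-antitone σ′≤σ (_ , minimum) ((D , D-mon , refl) , _) =
    minimum D (isDynMon-antitone σ′≤σ D-mon)

  closed? : ∀ σ H → Dec (Closed T W σ H)
  closed? σ H = all? λ v → v ∈? W →-dec (∣ H ∩ (N v ∩ W) ∣ ≥∞? σ v →-dec v ∈? H)

  isHull? : ∀ σ D H → Dec (IsHull T W σ D H)
  isHull? σ D H = H ⊆? W ×-dec D ⊆? H ×-dec closed? σ H ×-dec
    allSubset? λ H′ → H′ ⊆? W →-dec (D ⊆? H′ →-dec (closed? σ H′ →-dec H ⊆? H′))

  isDynMon? : ∀ σ D → Dec (IsDynMon T W σ D)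
  isDynMon? σ D = D ⊆? W ×-dec anySubset? λ H → isHull? σ D H ×-dec ≡-dec _≟ᵇ_ H W

  isDynMon-whole : ∀ σ → IsDynMon T W σ W
  isDynMon-whole σ = id , W , (id , id , (λ _ v∈W _ → v∈W) , (λ _ _ W⊆H′ _ → W⊆H′)) , refl

  isDyn-exists : ∀ σ → ∃ (IsDyn T W σ)
  isDyn-exists σ with least-witness sizes? (W , isDynMon-whole σ , refl)
    where
    sizes? : Decidable λ k → ∃ λ D → IsDynMon T W σ D × ∣ D ∣ ≡ k
    sizes? k = anySubset? λ D → isDynMon? σ D ×-dec ∣ D ∣ ≟ k
  ... | m , realised , minimum = m , realised , λ D D-mon → minimum (D , D-mon , refl)

  vacc-squeeze : ∀ {σ′ σ b m₁ m₀ X} → σ′ ≤τ σ → IsVacc T W σ b (just m₀) →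
                 X ⊆ W → ∣ X ∣ ≡ b → IsDyn T W (σ′ restrict X) m₁ →
                 ∃ λ d → IsDyn T W (σ restrict X) d × m₁ ≤ d × d ≤ m₀
  vacc-squeeze {σ = σ} {X = X} σ′≤σ (_ , maximum) X⊆W ∣X∣≡b dyn₁ with isDyn-exists (σ restrict X)
  ... | d , dyn = d , dyn , isDyn-antitone (restrict-mono X σ′≤σ) dyn₁ dyn , maximum X d X⊆W ∣X∣≡b dyn

  vacc-antitone : ∀ {σ′ σ : Threshold n} {b} (x₀ x₁ : Maybe ℕ) → σ′ ≤τ σ →
                  IsVacc T W σ b x₀ → IsVacc T W σ′ b x₁ →
                  (x₁ ≤⁻∞ x₀)
                  × (x₀ ≡ x₁ → b ≤ ∣ W ∣ →
                     ∃ λ X → X ⊆ W × ∣ X ∣ ≡ b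
                       × (∀ m → x₀ ≡ just m → IsDyn T W (σ restrict X) m)
                       × (∀ m → x₁ ≡ just m → IsDyn T W (σ′ restrict X) m))
  vacc-antitone {b = b} nothing nothing _ none _ =
    tt , λ _ b≤∣W∣ → let X , X⊆W , ∣X∣≡b = subset-of-size W b b≤∣W∣ in ⊥-elim (none X X⊆W ∣X∣≡b)
  vacc-antitone nothing (just _) _ none ((X , X⊆W , ∣X∣≡b , _) , _) = ⊥-elim (none X X⊆W ∣X∣≡b)
  vacc-antitone (just _) nothing _ _ _ = tt , λ ()
  vacc-antitone {σ = σ} (just m₀) (just m₁) σ′≤σ vacc₀ ((X , X⊆W , ∣X∣≡b , dyn₁) , _)
    with vacc-squeeze σ′≤σ vacc₀ X⊆W ∣X∣≡b dyn₁
  ... | d , dyn , m₁≤d , d≤m₀ = ≤-trans m₁≤d d≤m₀ , same-witness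
    where
    same-witness : just m₀ ≡ just m₁ → _
    same-witness refl _ = X , X⊆W , ∣X∣≡b
      , (λ { _ refl → subst (IsDyn T W (σ restrict X)) (≤-antisym d≤m₀ m₁≤d) dyn })
      , (λ { _ refl → dyn₁ })

-- The description of Tu as the descendants of u is not needed: the claim
-- holds for every vertex set.
lemma1 : ∀ {n} (T : RootedTree n) (τ : Threshold n) (u : Fin n) (b : ℕ)
         (Tu : Subset n) → (∀ w → (w ∈ Tu) ⇔ RootedTree.Descendant T u w) →
         (x₀ x₁ : Maybe ℕ) →
         IsVacc T Tu τ b x₀ → IsVacc T Tu (lower τ u) b x₁ →
         (x₁ ≤⁻∞ x₀)
         × (x₀ ≡ x₁ → b ≤ ∣ Tu ∣ →
            ∃ λ X → X ⊆ Tu × ∣ X ∣ ≡ b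
              × (∀ m → x₀ ≡ just m → IsDyn T Tu (τ restrict X) m)
              × (∀ m → x₁ ≡ just m → IsDyn T Tu (lower τ u restrict X) m))
lemma1 T τ u b Tu _ x₀ x₁ = vacc-antitone T Tu x₀ x₁ (lower-≤τ τ u)
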